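{- Let $s\ge 2$ and $w\in\Sigma_s^*$ with $\mathrm{supp}(w)=\Sigma_s$. Write $\mathcal{G}(w)=(X,Y,E)$, where $X$ consists of the vertices $(a_i,l)$ with $i$ odd and $Y$ of the vertices $(a_i,l)$ with $i$ even. Let $<_X$ be the linear order on $X$ given by the listing $(a_{2\lceil s/2\rceil-1},1),\dots,(a_{2\lceil s/2\rceil-1},|w|_{a_{2\lceil s/2\rceil-1}}),\ \dots,\ (a_3,1),\dots,(a_3,|w|_{a_3}),\ (a_1,1),\dots,(a_1,|w|_{a_1})$ (i.e. blocks of odd-indexed letters in decreasing order of index, each block in increasing order of the second coordinate), and let $<_Y$ be the linear order on $Y$ given by $(a_{2\lfloor s/2\rfloor},1),\dots,(a_{2\lfloor s/2\rfloor},|w|_{a_{2\lfloor s/2\rfloor}}),\ \dots,\ (a_4,1),\dots,(a_4,|w|_{a_4}),\ (a_2,1),\dots,(a_2,|w|_{a_2})$. Then $(<_X,<_Y)$ is a strong ordering on the vertices of $\mathcal{G}(w)$.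
   Context: $\Sigma_s$ denotes the ordered alphabet $\{a_1<a_2<\dots<a_s\}$; $\mathrm{supp}(w)$ is the set of letters occurring in $w$; $|w|_c$ is the number of occurrences of the letter $c$ in $w$; $\mathrm{pos}_c(w,k)$ is the position in $w$ of the $k$-th occurrence of $c$. Here the Parikh graph $\mathcal{G}(w)$ is taken with vertex set $\{(a_i,l): 1\le i\le s,\ 1\le l\le |w|_{a_i}\}$ (vertex $(a_i,l)$ corresponding to the $l$-th occurrence of $a_i$ in $w$), where $(a_i,l)$ and $(a_{i'},l')$ are adjacent if and only if $|i-i'|=1$ and $(i-i')(\mathrm{pos}_{a_i}(w,l)-\mathrm{pos}_{a_{i'}}(w,l'))>0$; equivalently, $(a_i,l)$ and $(a_{i+1},l')$ are adjacent iff $\mathrm{pos}_{a_i}(w,l)<\mathrm{pos}_{a_{i+1}}(w,l')$, and no other pairs are adjacent. For a bipartite graph $G=(X,Y,E)$, a strong ordering on its vertices is a pair $(<_X,<_Y)$ of linear orders on $X$ and on $Y$ such that for all edges $(x,y),(x',y')\in E$ with $x,x'\in X$, $y,y'\in Y$: if $x<_X x'$ and $y'<_Y y$, then $(x,y')\in E$ and $(x',y)\in E$. -}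

module Defs where

open import Level using (0ℓ)
open import Data.Nat using (ℕ; zero; suc; _≤_; _<_; _%_)
open import Data.Fin using (Fin; toℕ; _≟_)
open import Data.List using (List; []; _∷_)
open import Data.Product using (Σ; _×_; _,_)
open import Data.Sum using (_⊎_)
open import Relation.Nullary using (yes; no)
open import Relation.Binary.PropositionalEquality using (_≡_)
open import Relation.Binary.Structures using (IsStrictTotalOrder)

-- The ordered alphabet Σ_s = {a_1 < ... < a_s} is represented by Fin s:
-- the letter a_i corresponds to the element j : Fin s with toℕ j = i - 1.
Word : ℕ → Set
Word s = List (Fin s)

count : ∀ {s} → Fin s → Word s → ℕ
count c [] = 0
count c (x ∷ xs) with c ≟ x
... | yes _ = suc (count c xs)
... | no  _ = count c xs

-- pos_c(w,k) : (1-based) position in w of the k-th occurrence of c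
-- (only meaningful for 1 ≤ k ≤ |w|_c; junk value otherwise)
pos : ∀ {s} → Fin s → ℕ → Word s → ℕ
pos c k [] = 0
pos c k (x ∷ xs) with c ≟ x
pos c zero          (x ∷ xs) | yes _ = 0
pos c (suc zero)    (x ∷ xs) | yes _ = 1
pos c (suc (suc k)) (x ∷ xs) | yes _ = suc (pos c (suc k) xs)
pos c k             (x ∷ xs) | no  _ = suc (pos c k xs)

Vertex : ∀ {s} → Word s → Set
Vertex {s} w = Σ (Fin s) λ i → Σ ℕ λ l → 1 ≤ l × l ≤ count i w

-- Adjacency in G(w): |i - i'| = 1 and (i - i')(pos_{a_i}(w,l) - pos_{a_i'}(w,l')) > 0
Adjacent : ∀ {s} (w : Word s) → Vertex w → Vertex w → Set
Adjacent w (i , l , _) (i' , l' , _) =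
    (toℕ i' ≡ suc (toℕ i) × pos i l w < pos i' l' w)
  ⊎ (toℕ i ≡ suc (toℕ i') × pos i' l' w < pos i l w)

-- X : vertices (a_i, l) with i odd (i.e. toℕ of the index even)
XVertex : ∀ {s} → Word s → Set
XVertex {s} w = Σ (Fin s) λ i → (toℕ i % 2 ≡ 0) × (Σ ℕ λ l → 1 ≤ l × l ≤ count i w)

-- Y : vertices (a_i, l) with i even (i.e. toℕ of the index odd)
YVertex : ∀ {s} → Word s → Set
YVertex {s} w = Σ (Fin s) λ i → (toℕ i % 2 ≡ 1) × (Σ ℕ λ l → 1 ≤ l × l ≤ count i w)

XtoV : ∀ {s} {w : Word s} → XVertex w → Vertex w
XtoV (i , _ , v) = i , v

YtoV : ∀ {s} {w : Word s} → YVertex w → Vertex w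
YtoV (i , _ , v) = i , v

Edge : ∀ {s} (w : Word s) → XVertex w → YVertex w → Set
Edge w x y = Adjacent w (XtoV {w = w} x) (YtoV {w = w} y)

_<X_ : ∀ {s} {w : Word s} → XVertex w → XVertex w → Set
(i , _ , l , _) <X (i' , _ , l' , _) = (toℕ i' < toℕ i) ⊎ (i ≡ i' × l < l')

_<Y_ : ∀ {s} {w : Word s} → YVertex w → YVertex w → Set
(i , _ , l , _) <Y (i' , _ , l' , _) = (toℕ i' < toℕ i) ⊎ (i ≡ i' × l < l')

record IsStrongOrdering {X Y : Set} (E : X → Y → Set)
                        (_<x_ : X → X → Set) (_<y_ : Y → Y → Set) : Set where
  field
    linearX : IsStrictTotalOrder {A = X} _≡_ _<x_
    linearY : IsStrictTotalOrder {A = Y} _≡_ _<y_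
    strong  : ∀ x x' y y' → E x y → E x' y' → x <x x' → y' <y y →
              E x y' × E x' y

module Submission where

-- Write place(v) for the position in w of the occurrence v.
-- An edge of G(w) joins letters a_i, a_j with |i - j| = 1, and once the two
-- letters are fixed its orientation is fixed: for j = i + 1 the occurrences
-- (a_i,l), (a_j,m) are adjacent iff place(a_i,l) < place(a_j,m), and dually.
-- Since place is strictly increasing along the occurrences of one letter,
-- adjacency is monotone in the occurrence numbers.  In the exchange property
-- we have x <_X x' and y' <_Y y, so each pair either shares its letter or
-- the letter index strictly decreases.  If both letter indices change, the
-- four letters are forced to satisfy index(y) = index(x'), contradicting the
-- parity split between X and Y.  In each of the three remaining cases the
-- orientations of the two given edges are forced and the two required edges
-- follow by chaining inequalities between places.

open import Defs
open import Data.Nat using (ℕ; zero; suc; _≤_; _<_; _%_; z≤n; s≤s)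
open import Data.Nat.Properties
  using (<-trans; <-irrefl; <-asym; <-cmp; ≤-pred; ≤-refl; ≤-trans; ≤-antisym;
         n<1+n; n≤1+n; <⇒≤; ≡-irrelevant; ≤-irrelevant)
open import Data.Fin using (Fin; toℕ; _≟_)
open import Data.Fin.Properties using (toℕ-injective)
open import Data.List using ([]; _∷_)
open import Data.List.Membership.Propositional using (_∈_)
open import Data.Product using (Σ; _×_; _,_)
open import Data.Sum using (_⊎_; inj₁; inj₂)
open import Data.Empty using (⊥; ⊥-elim)
open import Relation.Nullary using (yes; no; ¬_)
open import Relation.Binary.PropositionalEquality
  using (_≡_; refl; sym; trans; cong; isEquivalence; resp₂)
open import Relation.Binary.Structures using (IsStrictTotalOrder)
open import Relation.Binary.Definitions using (Tri; tri<; tri≈; tri>)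

pos-positive : ∀ {s} (c : Fin s) (w : Word s) k →
               1 ≤ k → k ≤ count c w → 1 ≤ pos c k w
pos-positive c [] zero    () _
pos-positive c [] (suc k) _  ()
pos-positive c (x ∷ w) k _ _ with c ≟ x
pos-positive c (x ∷ w) (suc zero)    _ _ | yes _ = s≤s z≤n
pos-positive c (x ∷ w) (suc (suc k)) _ _ | yes _ = s≤s z≤n
pos-positive c (x ∷ w) k             _ _ | no  _ = s≤s z≤n

pos-increasing : ∀ {s} (c : Fin s) (w : Word s) k k' →
                 1 ≤ k → k < k' → k' ≤ count c w → pos c k w < pos c k' w
pos-increasing c [] k zero     _ () _
pos-increasing c [] k (suc k') _ _  ()
pos-increasing c (x ∷ w) k k' _ _ _ with c ≟ x
pos-increasing c (x ∷ w) (suc zero) (suc (suc k')) _ _ k'≤ | yes _ =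
  s≤s (pos-positive c w (suc k') (s≤s z≤n) (≤-pred k'≤))
pos-increasing c (x ∷ w) (suc (suc k)) (suc (suc k')) _ k<k' k'≤ | yes _ =
  s≤s (pos-increasing c w (suc k) (suc k') (s≤s z≤n) (≤-pred k<k') (≤-pred k'≤))
pos-increasing c (x ∷ w) (suc zero)    (suc zero) _ (s≤s ()) _ | yes _
pos-increasing c (x ∷ w) (suc (suc k)) (suc zero) _ (s≤s ()) _ | yes _
pos-increasing c (x ∷ w) k k' 1≤k k<k' k'≤ | no _ =
  s≤s (pos-increasing c w k k' 1≤k k<k' k'≤)

-- With P = "index has parity r" this is exactly <_X resp. <_Y.
module BlockOrder {s} (w : Word s) (P : Fin s → Set)
                  (P-irrelevant : ∀ {i} (p q : P i) → p ≡ q) where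

  Block : Set
  Block = Σ (Fin s) λ i → P i × Σ ℕ λ l → 1 ≤ l × l ≤ count i w

  _≺_ : Block → Block → Set
  (i , _ , l , _) ≺ (i' , _ , l' , _) = (toℕ i' < toℕ i) ⊎ (i ≡ i' × l < l')

  occurrence-≡ : ∀ i (p p' : P i) l a a' b b' →
                 _≡_ {A = Block} (i , p , l , a , b) (i , p' , l , a' , b')
  occurrence-≡ i p p' l a a' b b'
    with P-irrelevant p p' | ≤-irrelevant a a' | ≤-irrelevant b b'
  ... | refl | refl | refl = refl

  ≺-irrefl : ∀ {u v} → u ≡ v → ¬ (u ≺ v)
  ≺-irrefl refl (inj₁ i<i)       = <-irrefl refl i<i
  ≺-irrefl refl (inj₂ (_ , l<l)) = <-irrefl refl l<l

  ≺-trans : ∀ {u v t} → u ≺ v → v ≺ t → u ≺ t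
  ≺-trans (inj₁ p)            (inj₁ q)            = inj₁ (<-trans q p)
  ≺-trans (inj₁ p)            (inj₂ (refl , _))   = inj₁ p
  ≺-trans (inj₂ (refl , _))   (inj₁ q)            = inj₁ q
  ≺-trans (inj₂ (refl , p))   (inj₂ (refl , q))   = inj₂ (refl , <-trans p q)

  from-< : ∀ {u v} → u ≺ v → Tri (u ≺ v) (u ≡ v) (v ≺ u)
  from-< {u} {v} u≺v = tri< u≺v (λ u≡v → ≺-irrefl {u} {v} u≡v u≺v)
                             (λ v≺u → ≺-irrefl {u} {u} refl (≺-trans {u} {v} {u} u≺v v≺u))

  from-> : ∀ {u v} → v ≺ u → Tri (u ≺ v) (u ≡ v) (v ≺ u)
  from-> {u} {v} v≺u = tri> (λ u≺v → ≺-irrefl {v} {v} refl (≺-trans {v} {u} {v} v≺u u≺v))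
                             (λ u≡v → ≺-irrefl {v} {u} (sym u≡v) v≺u) v≺u

  ≺-compare : ∀ u v → Tri (u ≺ v) (u ≡ v) (v ≺ u)
  ≺-compare u@(i , p , l , a , b) v@(i' , p' , l' , a' , b') with <-cmp (toℕ i') (toℕ i)
  ... | tri< i'<i _ _ = from-< {u} {v} (inj₁ i'<i)
  ... | tri> _ _ i<i' = from-> {u} {v} (inj₁ i<i')
  ... | tri≈ _ i'≡i _ with toℕ-injective i'≡i
  ... | refl with <-cmp l l'
  ... | tri< l<l' _ _ = from-< {u} {v} (inj₂ (refl , l<l'))
  ... | tri> _ _ l'<l = from-> {u} {v} (inj₂ (refl , l'<l))
  ... | tri≈ _ refl _ =
        tri≈ (≺-irrefl {u} {u} refl) (occurrence-≡ i p p' l a a' b b') (≺-irrefl {u} {u} refl)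

  ≺-isStrictTotalOrder : IsStrictTotalOrder _≡_ _≺_
  ≺-isStrictTotalOrder = record
    { isStrictPartialOrder = record
      { isEquivalence = isEquivalence
      ; irrefl        = λ {u} {v} → ≺-irrefl {u} {v}
      ; trans         = λ {u} {v} {t} → ≺-trans {u} {v} {t}
      ; <-resp-≈      = resp₂ _≺_
      }
    ; compare = ≺-compare
    }

Neighbours : ℕ → ℕ → Set
Neighbours I J = J ≡ suc I ⊎ I ≡ suc J

neighbours-sym : ∀ {I J} → Neighbours I J → Neighbours J I
neighbours-sym (inj₁ J≡1+I) = inj₂ J≡1+I
neighbours-sym (inj₂ I≡1+J) = inj₁ I≡1+J

not-both-ways : ∀ {I J} → J ≡ suc I → I ≡ suc J → ⊥
not-both-ways {I} refl I≡2+I = <-irrefl I≡2+I (<-trans (n<1+n I) (n<1+n (suc I)))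

neighbour-≤ : ∀ {I J} → Neighbours I J → J ≤ suc I
neighbour-≤ (inj₁ refl) = ≤-refl
neighbour-≤ (inj₂ refl) = <⇒≤ (<-trans (n<1+n _) (n<1+n _))

between-neighbours : ∀ {K A B} → Neighbours K A → Neighbours K B → A < B →
                     K ≡ suc A × B ≡ suc K
between-neighbours (inj₂ K≡1+A) (inj₁ B≡1+K) _   = K≡1+A , B≡1+K
between-neighbours (inj₁ refl)  (inj₁ refl)  A<B = ⊥-elim (<-irrefl refl A<B)
between-neighbours (inj₁ refl)  (inj₂ refl)  A<B =
  ⊥-elim (<-asym A<B (<-trans (n<1+n _) (n<1+n _)))
between-neighbours (inj₂ refl)  (inj₂ refl)  A<B = ⊥-elim (<-irrefl refl A<B)

crossing-neighbours : ∀ {I I' J J'} → I' < I → J < J' →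
                      Neighbours I J → Neighbours I' J' → J ≡ I'
crossing-neighbours I'<I J<J' (inj₁ refl) nb' =
  ⊥-elim (<-irrefl refl (≤-trans (n≤1+n _) (≤-trans J<J' (≤-trans (neighbour-≤ nb') I'<I))))
crossing-neighbours I'<I J<J' (inj₂ refl) nb' =
  ≤-antisym (≤-pred (≤-trans J<J' (neighbour-≤ nb'))) (≤-pred I'<I)

module Adjacency {s} (w : Word s) where

  index : Vertex w → ℕ
  index (i , _) = toℕ i

  place : Vertex w → ℕ
  place (i , l , _) = pos i l w

  _⋖_ : Vertex w → Vertex w → Set
  (i , l , _) ⋖ (i' , l' , _) = i ≡ i' × l < l'

  earlier : ∀ {u u'} → u ⋖ u' → place u < place u'
  earlier {i , l , 1≤l , _} {.i , l' , _ , l'≤} (refl , l<l') =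
    pos-increasing i w l l' 1≤l l<l' l'≤

  adjacent-neighbours : ∀ {u v} → Adjacent w u v → Neighbours (index u) (index v)
  adjacent-neighbours (inj₁ (up , _))   = inj₁ up
  adjacent-neighbours (inj₂ (down , _)) = inj₂ down

  upward : ∀ {u v} → index v ≡ suc (index u) → Adjacent w u v → place u < place v
  upward _  (inj₁ (_ , u<v))    = u<v
  upward up (inj₂ (down , _))   = ⊥-elim (not-both-ways up down)

  downward : ∀ {u v} → index u ≡ suc (index v) → Adjacent w u v → place v < place u
  downward down (inj₁ (up , _)) = ⊥-elim (not-both-ways up down)
  downward _    (inj₂ (_ , v<u)) = v<u

  exchange-same-letters : ∀ {u u' v v'} → u ⋖ u' → v' ⋖ v →
    Adjacent w u v → Adjacent w u' v' → Adjacent w u v' × Adjacent w u' v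
  exchange-same-letters {u} {u'} {v} {v'} u⋖u'@(refl , _) v'⋖v@(refl , _) e f
    with adjacent-neighbours {u} {v} e
  ... | inj₁ up =
      inj₁ (up , <-trans (earlier {u} {u'} u⋖u') (upward {u'} {v'} up f))
    , inj₁ (up , <-trans (upward {u'} {v'} up f) (earlier {v'} {v} v'⋖v))
  ... | inj₂ down =
      inj₂ (down , <-trans (earlier {v'} {v} v'⋖v) (downward {u} {v} down e))
    , inj₂ (down , <-trans (downward {u} {v} down e) (earlier {u} {u'} u⋖u'))

  -- Exchange when u, u' share their letter and v lies below v':
  -- then v is the letter below and v' the letter above.
  exchange-shared-first : ∀ {u u' v v'} → u ⋖ u' → index v < index v' →
    Adjacent w u v → Adjacent w u' v' → Adjacent w u v' × Adjacent w u' v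
  exchange-shared-first {u} {u'} {v} {v'} u⋖u'@(refl , _) v<v' e f
    with between-neighbours (adjacent-neighbours {u} {v} e)
                            (adjacent-neighbours {u'} {v'} f) v<v'
  ... | down , up =
      inj₁ (up , <-trans (earlier {u} {u'} u⋖u') (upward {u'} {v'} up f))
    , inj₂ (down , <-trans (downward {u} {v} down e) (earlier {u} {u'} u⋖u'))

  -- Exchange when v, v' share their letter and u' lies below u:
  -- then u' is the letter below and u the letter above.
  exchange-shared-second : ∀ {u u' v v'} → v' ⋖ v → index u' < index u →
    Adjacent w u v → Adjacent w u' v' → Adjacent w u v' × Adjacent w u' v
  exchange-shared-second {u} {u'} {v} {v'} v'⋖v@(refl , _) u'<u e f
    with between-neighbours (neighbours-sym (adjacent-neighbours {u'} {v'} f))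
                            (neighbours-sym (adjacent-neighbours {u} {v} e)) u'<u
  ... | up , down =
      inj₂ (down , <-trans (earlier {v'} {v} v'⋖v) (downward {u} {v} down e))
    , inj₁ (up , <-trans (upward {u'} {v'} up f) (earlier {v'} {v} v'⋖v))

  xv : XVertex w → Vertex w
  xv = XtoV {w = w}

  yv : YVertex w → Vertex w
  yv = YtoV {w = w}

  -- The exchange property of (<_X, <_Y): the three cases above, and the
  -- case where both letters change, which would make an even index odd.
  parikh-exchange : ∀ x x' y y' → Edge w x y → Edge w x' y' →
                    _<X_ {s} {w} x x' → _<Y_ {s} {w} y' y → Edge w x y' × Edge w x' y
  parikh-exchange x x' y y' e f (inj₂ x⋖x') (inj₂ y'⋖y) =
    exchange-same-letters {xv x} {xv x'} {yv y} {yv y'} x⋖x' y'⋖y e f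
  parikh-exchange x x' y y' e f (inj₂ x⋖x') (inj₁ j<j') =
    exchange-shared-first {xv x} {xv x'} {yv y} {yv y'} x⋖x' j<j' e f
  parikh-exchange x x' y y' e f (inj₁ i'<i) (inj₂ y'⋖y) =
    exchange-shared-second {xv x} {xv x'} {yv y} {yv y'} y'⋖y i'<i e f
  parikh-exchange x x'@(_ , even , _) y@(_ , odd , _) y' e f (inj₁ i'<i) (inj₁ j<j')
    with crossing-neighbours i'<i j<j' (adjacent-neighbours {xv x} {yv y} e)
                                       (adjacent-neighbours {xv x'} {yv y'} f)
  ... | j≡i' with trans (sym odd) (trans (cong (_% 2) j≡i') even)
  ... | ()

lemma4p3 : (s : ℕ) → 2 ≤ s → (w : Word s) → (∀ (c : Fin s) → c ∈ w) →
    IsStrongOrdering (Edge w) (_<X_ {s} {w}) (_<Y_ {s} {w})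
lemma4p3 s _ w _ = record
  { linearX = BlockOrder.≺-isStrictTotalOrder w (λ i → toℕ i % 2 ≡ 0) ≡-irrelevant
  ; linearY = BlockOrder.≺-isStrictTotalOrder w (λ i → toℕ i % 2 ≡ 1) ≡-irrelevant
  ; strong  = Adjacency.parikh-exchange w
  }
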